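{- Every $2\times 2$ minimizer is density isomorphic to a refinement of $\begin{pmatrix}0&1\\1&0\end{pmatrix}$ or to a refinement of $\begin{pmatrix}0&0\\1&2\end{pmatrix}$.
   Context: Matrices have entries from an arbitrary set of symbols. For an $h\times h$ matrix $H$ and an $n\times n$ matrix $M$ with $n\ge h$, an $h\times h$ submatrix of $M$ is obtained by choosing rows $i_1<\dots<i_h$ and columns $j_1<\dots<j_h$, its $(k,l)$ entry being $M(i_k,j_l)$. The density $d(H,M)$ is the number of $h\times h$ submatrices of $M$ equal to $H$ divided by $\binom{n}{h}^2$. Let $f(H,n)$ be the maximum of $d(H,M)$ over all $n\times n$ matrices $M$, and $f(H)=\lim_{n\to\infty}f(H,n)$. An $h\times h$ matrix $H$ is a minimizer if $f(H)=(h!)^2/h^{2h}$. For matrices $H,H^*$ of the same order, $H^*$ is a refinement of $H$ if $H(i,j)\ne H(i',j')$ implies $H^*(i,j)\neq H^*(i',j')$ for all entries $(i,j),(i',j')$. Two matrices are density isomorphic if one is obtained from the other by a sequence of the operations: reversing the order of the rows, reversing the order of the columns, transposing, and bijectively renaming the symbols. -}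

module Defs where

open import Data.Nat using (ℕ; zero; suc; _≤_; _^_; _*_; _≡ᵇ_; _<ᵇ_; NonZero; _!)
open import Data.Nat.Combinatorics using (_C_)
open import Data.Fin using (Fin; toℕ; opposite; zero; suc)
open import Data.List using (List; map; allFin)
open import Data.Nat.ListAction using (sum)
open import Data.Bool using (Bool; true; false; _∧_; if_then_else_)
open import Data.Integer using (+_)
open import Data.Rational using (ℚ; _/_; _+_; _-_) renaming (_≤_ to _≤ℚ_)
open import Data.Product using (Σ; ∃; _×_)
open import Data.Sum using (_⊎_)
open import Relation.Nullary using (¬_)
open import Relation.Binary.PropositionalEquality using (_≡_)
open import Relation.Binary.Construct.Closure.ReflexiveTransitive using (Star)
open import Function.Bundles using (_⤖_; Bijection)

-- Symbols are natural numbers (an unbounded supply of symbols).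
-- n×n matrix over symbols
Mat : ℕ → Set
Mat n = Fin n → Fin n → ℕ

Mat2 : Set
Mat2 = Mat 2

∑ : (n : ℕ) → (Fin n → ℕ) → ℕ
∑ n f = sum (map f (allFin n))

occ : {n : ℕ} → Mat2 → Mat n → Fin n → Fin n → Fin n → Fin n → ℕ
occ H M i₁ i₂ j₁ j₂ =
  if (toℕ i₁ <ᵇ toℕ i₂) ∧ (toℕ j₁ <ᵇ toℕ j₂)
     ∧ (M i₁ j₁ ≡ᵇ H zero zero) ∧ (M i₁ j₂ ≡ᵇ H zero (suc zero))
     ∧ (M i₂ j₁ ≡ᵇ H (suc zero) zero) ∧ (M i₂ j₂ ≡ᵇ H (suc zero) (suc zero))
  then 1 else 0

count : {n : ℕ} → Mat2 → Mat n → ℕ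
count {n} H M = ∑ n λ i₁ → ∑ n λ i₂ → ∑ n λ j₁ → ∑ n λ j₂ → occ H M i₁ i₂ j₁ j₂

denom : ℕ → ℕ
denom n = (n C 2) ^ 2

density : (n : ℕ) → .{{_ : NonZero (denom n)}} → Mat2 → Mat n → ℚ
density n H M = (+ count H M) / denom n

-- lim_{n→∞} f(H,n) = c, where f(H,n) = max_M d(H,M):
-- for every ε = 1/(k+1) there is N such that for all n ≥ N,
-- every M has d(H,M) ≤ c + ε and some M has d(H,M) ≥ c - ε.
LimMaxDensity : Mat2 → ℚ → Set
LimMaxDensity H c =
  (k : ℕ) → ∃ λ N → (n : ℕ) → N ≤ n → .{{_ : NonZero (denom n)}} →
    ((M : Mat n) → density n H M ≤ℚ c + (+ 1 / suc k))
    × (∃ λ (M : Mat n) → c - (+ 1 / suc k) ≤ℚ density n H M)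

-- (h!)^2 / h^(2h) for h = 2
minValue2 : ℚ
minValue2 = + ((2 !) * (2 !)) / (2 ^ (2 * 2))

Minimizer2 : Mat2 → Set
Minimizer2 H = LimMaxDensity H minValue2

IsRefinement : Mat2 → Mat2 → Set
IsRefinement H* H = ∀ i j i' j' → ¬ (H i j ≡ H i' j') → ¬ (H* i j ≡ H* i' j')

data DIStep : Mat2 → Mat2 → Set where
  revRows   : ∀ H → DIStep H (λ i j → H (opposite i) j)
  revCols   : ∀ H → DIStep H (λ i j → H i (opposite j))
  transpose : ∀ H → DIStep H (λ i j → H j i)
  rename    : ∀ H (g : ℕ ⤖ ℕ) → DIStep H (λ i j → Bijection.to g (H i j))

DensityIso : Mat2 → Mat2 → Set
DensityIso = Star DIStep

A₀ : Mat2
A₀ zero zero = 0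
A₀ zero (suc zero) = 1
A₀ (suc zero) zero = 1
A₀ (suc zero) (suc zero) = 0

B₀ : Mat2
B₀ zero zero = 0
B₀ zero (suc zero) = 0
B₀ (suc zero) zero = 1
B₀ (suc zero) (suc zero) = 2

{-# OPTIONS --safe #-}
-- Up to density isomorphism, a 2×2 matrix H that is neither a refinement of A₀ nor of B₀
-- has so many coinciding entries that it is the image, under a map of symbols, of one of six
-- two-symbol patterns P: a single 1 among 0s, two constant rows, or two constant columns.
-- Each such P occurs in at least 40 of the 100 2×2 submatrices of a suitable 5×5 matrix B.
-- Blowing every entry of B up into a constant t×t block and renaming symbols gives 5t×5t
-- matrices containing at least 40 t⁴ copies of H among binom(5t,2)² ≤ (5t)⁴/4 submatrices,
-- a density of at least 160/625 > 1/4 + 1/200; so f(H) ≠ 1/4.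
module Submission where

open import Defs
open import Data.Bool using (true; false; T; _∧_; if_then_else_)
open import Data.Bool.Properties using (T-∧)
open import Data.Empty using (⊥-elim)
open import Data.Fin using (Fin; zero; suc; toℕ; opposite; combine; quotient; _↑ˡ_; _↑ʳ_)
open import Data.Fin.Patterns using (0F; 1F)
open import Data.Fin.Properties using (remQuot-combine; combine-monoˡ-<) renaming (_≟_ to _≟ᶠ_)
import Data.Integer as ℤ
import Data.Integer.Properties as ℤ
open import Data.Integer.GCD using (gcd)
open import Data.List.Properties using (map-tabulate)
open import Data.Nat
  using (ℕ; zero; suc; _+_; _*_; _^_; _≤_; _≡ᵇ_; _<ᵇ_; _≤ᵇ_; z≤n; s≤s; NonZero; >-nonZero)
open import Data.Nat.Combinatorics using (_C_; nC1≡n; nCk+nC[k+1]≡[n+1]C[k+1])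
open import Data.Nat.ListAction using (sum)
open import Data.Nat.Tactic.RingSolver using (solve-∀)
open import Data.Nat.Properties
open import Data.Product as Product using (∃; _×_; _,_; proj₁; proj₂)
open import Data.Rational using (↥_; ↧_; _/_) renaming (_≤_ to _≤ℚ_; _+_ to _+ℚ_)
open import Data.Rational.Properties using (drop-*≤*; ↥-/; ↧-/)
open import Data.Sum using (_⊎_; inj₁; inj₂)
open import Data.Vec using (Vec; _∷_; []; lookup)
open import Function using (_∘_; id; const; Equivalence)
open import Relation.Nullary using (¬_; does; yes; no; contradiction)
open import Relation.Binary.Construct.Closure.ReflexiveTransitive using (ε; _◅_)
open import Relation.Binary.PropositionalEquality

import Algebra.Properties.CommutativeSemigroup ℤ.*-commutativeSemigroup as ℤ*
import Algebra.Properties.CommutativeSemigroup *-commutativeSemigroup as ℕ*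
open import Algebra.Properties.CommutativeSemiring.Exp +-*-commutativeSemiring using (^-distrib-*)

/-≤⇒*≤* : ∀ i n .{{_ : NonZero n}} q → i / n ≤ℚ q → i ℤ.* ↧ q ℤ.≤ ↥ q ℤ.* ℤ.+ n
/-≤⇒*≤* i n q i/n≤q = subst₂ ℤ._≤_ lhs rhs (ℤ.*-monoʳ-≤-nonNeg g (drop-*≤* i/n≤q))
  where
  g = gcd i (ℤ.+ n)
  lhs : (↥ (i / n) ℤ.* ↧ q) ℤ.* g ≡ i ℤ.* ↧ q
  lhs = trans (ℤ*.xy∙z≈xz∙y (↥ (i / n)) (↧ q) g) (cong (ℤ._* ↧ q) (↥-/ i n))
  rhs : (↥ q ℤ.* ↧ (i / n)) ℤ.* g ≡ ↥ q ℤ.* ℤ.+ n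
  rhs = trans (ℤ.*-assoc (↥ q) (↧ (i / n)) g) (cong (↥ q ℤ.*_) (↧-/ i n))

-- minValue2 + 1/200 normalises to 51/200.
≤minValue2+1/200⇒ : ∀ c d .{{_ : NonZero d}} → ℤ.+ c / d ≤ℚ minValue2 +ℚ ℤ.+ 1 / 200 → c * 200 ≤ 51 * d
≤minValue2+1/200⇒ c d c/d≤ =
  ℤ.drop‿+≤+ (subst₂ ℤ._≤_ (sym (ℤ.pos-* c 200)) (sym (ℤ.pos-* 51 d)) (/-≤⇒*≤* (ℤ.+ c) d _ c/d≤))

∑-suc : ∀ n (f : Fin (suc n) → ℕ) → ∑ (suc n) f ≡ f zero + ∑ n (f ∘ suc)
∑-suc n f = cong (λ xs → f zero + sum xs) (trans (map-tabulate suc f) (sym (map-tabulate id (f ∘ suc))))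

∑-↑ : ∀ m n (f : Fin (m + n) → ℕ) → ∑ (m + n) f ≡ ∑ m (f ∘ (_↑ˡ n)) + ∑ n (f ∘ (m ↑ʳ_))
∑-↑ zero    n f = refl
∑-↑ (suc m) n f = begin
  ∑ (suc m + n) f                            ≡⟨ ∑-suc (m + n) f ⟩
  f zero + ∑ (m + n) (f ∘ suc)               ≡⟨ cong (f zero +_) (∑-↑ m n (f ∘ suc)) ⟩
  f zero + (left + right)                    ≡⟨ +-assoc (f zero) left right ⟨
  f zero + left + right                      ≡⟨ cong (_+ right) (∑-suc m (f ∘ (_↑ˡ n))) ⟨
  ∑ (suc m) (f ∘ (_↑ˡ n)) + right            ∎
  where
  open ≡-Reasoning
  left  = ∑ m (f ∘ suc ∘ (_↑ˡ n))
  right = ∑ n (f ∘ (suc m ↑ʳ_))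

*≤∑ : ∀ n {c} {f : Fin n → ℕ} → (∀ i → c ≤ f i) → n * c ≤ ∑ n f
*≤∑ zero    c≤f = z≤n
*≤∑ (suc n) {c} {f} c≤f =
  subst (suc n * c ≤_) (sym (∑-suc n f)) (+-mono-≤ (c≤f zero) (*≤∑ n (c≤f ∘ suc)))

-- The factor m lets the lemma be nested once per summation index of count.
∑-combine-≥ : ∀ k t {m} {g : Fin k → ℕ} {F : Fin (k * t) → ℕ} →
              (∀ r a → m * g r ≤ F (combine r a)) → (t * m) * ∑ k g ≤ ∑ (k * t) F
∑-combine-≥ zero    t {m} g≤F = ≤-reflexive (*-zeroʳ (t * m))
∑-combine-≥ (suc k) t {m} {g} {F} g≤F = begin
  (t * m) * ∑ (suc k) g                            ≡⟨ cong ((t * m) *_) (∑-suc k g) ⟩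
  (t * m) * (g zero + rest)                        ≡⟨ *-distribˡ-+ (t * m) (g zero) rest ⟩
  (t * m) * g zero + (t * m) * rest                ≡⟨ cong (_+ (t * m) * rest) (*-assoc t m (g zero)) ⟩
  t * (m * g zero) + (t * m) * rest                ≤⟨ +-mono-≤ (*≤∑ t (g≤F zero)) (∑-combine-≥ k t (g≤F ∘ suc)) ⟩
  ∑ t (F ∘ (_↑ˡ k * t)) + ∑ (k * t) (F ∘ (t ↑ʳ_))  ≡⟨ ∑-↑ t (k * t) F ⟨
  ∑ (suc k * t) F                                  ∎
  where
  open ≤-Reasoning
  rest = ∑ k (g ∘ suc)

blowUp : ∀ {k} t → (ℕ → ℕ) → Mat k → Mat (k * t)
blowUp t σ B i j = σ (B (quotient t i) (quotient t j))

if-mono : ∀ {b b′} → (T b → T b′) → (if b then 1 else 0) ≤ (if b′ then 1 else 0)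
if-mono {false}           _    = z≤n
if-mono {true}  {true}    _    = ≤-refl
if-mono {true}  {false}   b⇒b′ = ⊥-elim (b⇒b′ _)

∧-map : ∀ {a a′ b b′} → (T a → T a′) → (T b → T b′) → T (a ∧ b) → T (a′ ∧ b′)
∧-map f g = Equivalence.from T-∧ ∘ Product.map f g ∘ Equivalence.to T-∧

module _ {H P : Mat2} {σ : ℕ → ℕ} (H≗σ∘P : ∀ i j → H i j ≡ σ (P i j)) {k t : ℕ} (B : Mat k) where

  private
    <ᵇ-combine : ∀ {r r′ : Fin k} (a a′ : Fin t) →
                 T (toℕ r <ᵇ toℕ r′) → T (toℕ (combine r a) <ᵇ toℕ (combine r′ a′))
    <ᵇ-combine {r} {r′} a a′ = <⇒<ᵇ ∘ combine-monoˡ-< a a′ ∘ <ᵇ⇒< (toℕ r) (toℕ r′)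

    ≡ᵇ-blowUp : ∀ r c (a b : Fin t) i j →
                T (B r c ≡ᵇ P i j) → T (blowUp t σ B (combine r a) (combine c b) ≡ᵇ H i j)
    ≡ᵇ-blowUp r c a b i j Brc≡Pij = ≡⇒≡ᵇ _ _ (begin
      σ (B (quotient t (combine r a)) (quotient t (combine c b)))
        ≡⟨ cong₂ (λ r c → σ (B r c)) (cong proj₁ (remQuot-combine r a)) (cong proj₁ (remQuot-combine c b)) ⟩
      σ (B r c) ≡⟨ cong σ (≡ᵇ⇒≡ _ _ Brc≡Pij) ⟩
      σ (P i j) ≡⟨ H≗σ∘P i j ⟨
      H i j     ∎)
      where open ≡-Reasoning

  occ-blowUp-≥ : ∀ r₁ r₂ c₁ c₂ a₁ a₂ b₁ b₂ → occ P B r₁ r₂ c₁ c₂ ≤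
                 occ H (blowUp t σ B) (combine r₁ a₁) (combine r₂ a₂) (combine c₁ b₁) (combine c₂ b₂)
  occ-blowUp-≥ r₁ r₂ c₁ c₂ a₁ a₂ b₁ b₂ = if-mono
    (∧-map (<ᵇ-combine a₁ a₂) (∧-map (<ᵇ-combine b₁ b₂)
    (∧-map (≡ᵇ-blowUp r₁ c₁ a₁ b₁ _ _) (∧-map (≡ᵇ-blowUp r₁ c₂ a₁ b₂ _ _)
    (∧-map (≡ᵇ-blowUp r₂ c₁ a₂ b₁ _ _) (≡ᵇ-blowUp r₂ c₂ a₂ b₂ _ _))))))

  count-blowUp-≥ : t ^ 4 * count P B ≤ count H (blowUp t σ B)
  count-blowUp-≥ =
    ∑-combine-≥ k t λ r₁ a₁ → ∑-combine-≥ k t λ r₂ a₂ →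
    ∑-combine-≥ k t λ c₁ b₁ → ∑-combine-≥ k t λ c₂ b₂ →
    ≤-trans (≤-reflexive (*-identityˡ _)) (occ-blowUp-≥ r₁ r₂ c₁ c₂ a₁ a₂ b₁ b₂)

[1+n]C2≡n+nC2 : ∀ n → suc n C 2 ≡ n + n C 2
[1+n]C2≡n+nC2 n = trans (sym (nCk+nC[k+1]≡[n+1]C[k+1] n 1)) (cong (_+ n C 2) (nC1≡n n))

2*nC2+n≡n*n : ∀ n → 2 * (n C 2) + n ≡ n * n
2*nC2+n≡n*n zero    = refl
2*nC2+n≡n*n (suc n) = begin
  2 * (suc n C 2) + suc n          ≡⟨ cong (λ x → 2 * x + suc n) ([1+n]C2≡n+nC2 n) ⟩
  2 * (n + n C 2) + suc n          ≡⟨ regroup n (n C 2) ⟩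
  (2 * (n C 2) + n) + (2 * n + 1)  ≡⟨ cong (_+ (2 * n + 1)) (2*nC2+n≡n*n n) ⟩
  n * n + (2 * n + 1)              ≡⟨ square-suc n ⟩
  suc n * suc n                    ∎
  where
  open ≡-Reasoning
  regroup : ∀ n c → 2 * (n + c) + suc n ≡ (2 * c + n) + (2 * n + 1)
  regroup = solve-∀
  square-suc : ∀ n → n * n + (2 * n + 1) ≡ suc n * suc n
  square-suc = solve-∀

4*denom≤n^4 : ∀ n → 4 * denom n ≤ n ^ 4
4*denom≤n^4 n = begin
  4 * denom n            ≡⟨ ^-distrib-* 2 (n C 2) 2 ⟨
  (2 * (n C 2)) ^ 2      ≤⟨ ^-monoˡ-≤ 2 (subst (2 * (n C 2) ≤_) (2*nC2+n≡n*n n) (m≤m+n _ n)) ⟩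
  (n * n) ^ 2            ≡⟨ ^-distrib-* n n 2 ⟩
  n ^ 2 * n ^ 2          ≡⟨ ^-distribˡ-+-* n 2 2 ⟨
  n ^ 4                  ∎
  where open ≤-Reasoning

denom-nonZero : ∀ {n} → 2 ≤ n → NonZero (denom n)
denom-nonZero {suc (suc n)} (s≤s (s≤s _)) =
  subst (λ c → NonZero (c ^ 2)) (sym ([1+n]C2≡n+nC2 (suc n))) (m^n≢0 (suc n + suc n C 2) 2)

IsImageOf : Mat2 → Mat2 → Set
IsImageOf H P = ∃ λ (σ : ℕ → ℕ) → ∀ i j → H i j ≡ σ (P i j)

minimizer⇒count-image-≤ : ∀ {H P k} → Minimizer2 H → IsImageOf H P → 2 ≤ k → (B : Mat k) →
                          800 * count P B ≤ 51 * k ^ 4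
minimizer⇒count-image-≤ {H} {P} {k} minimizer (σ , H≗σ∘P) 2≤k B =
  *-cancelʳ-≤ (800 * count P B) (51 * k ^ 4) (t ^ 4) {{m^n≢0 t 4}} (begin
    800 * count P B * t ^ 4        ≡⟨ regroup (count P B) (t ^ 4) ⟩
    4 * (t ^ 4 * count P B * 200)  ≤⟨ *-monoʳ-≤ 4 (*-monoˡ-≤ 200 blowUp-count) ⟩
    4 * (count H M * 200)          ≤⟨ *-monoʳ-≤ 4 count≤ ⟩
    4 * (51 * denom n)             ≡⟨ ℕ*.x∙yz≈y∙xz 4 51 (denom n) ⟩
    51 * (4 * denom n)             ≤⟨ *-monoʳ-≤ 51 (4*denom≤n^4 n) ⟩
    51 * n ^ 4                     ≡⟨ cong (51 *_) (^-distrib-* k t 4) ⟩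
    51 * (k ^ 4 * t ^ 4)           ≡⟨ *-assoc 51 (k ^ 4) (t ^ 4) ⟨
    51 * k ^ 4 * t ^ 4             ∎)
  where
  open ≤-Reasoning
  -- ε = 1/200; the blow-up of B to size k (N + 1) lies beyond the threshold N.
  N = proj₁ (minimizer 199)
  t = suc N
  n = k * t
  instance
    _ : NonZero k
    _ = >-nonZero (≤-trans (s≤s z≤n) 2≤k)
    _ : NonZero (denom n)
    _ = denom-nonZero (≤-trans 2≤k (m≤m*n k t))
  M = blowUp t σ B
  blowUp-count : t ^ 4 * count P B ≤ count H M
  blowUp-count = count-blowUp-≥ {H} {P} {σ} H≗σ∘P {k} {t} B
  count≤ : count H M * 200 ≤ 51 * denom n
  count≤ = ≤minValue2+1/200⇒ (count H M) (denom n)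
             (proj₁ (proj₂ (minimizer 199) n (≤-trans (n≤1+n N) (m≤n*m t k))) M)
  regroup : ∀ c s → 800 * c * s ≡ 4 * (s * c * 200)
  regroup = solve-∀

oneAt : Fin 2 → Fin 2 → Mat2
oneAt i j i′ j′ = if does (i ≟ᶠ i′) ∧ does (j ≟ᶠ j′) then 1 else 0

rowIndex : Mat2
rowIndex i _ = toℕ i

colIndex : Mat2
colIndex _ j = toℕ j

data Packable : Mat2 → Set where
  single   : ∀ i j → Packable (oneAt i j)
  byRow    : Packable rowIndex
  byColumn : Packable colIndex

staircase : Mat 5
staircase r c = lookup (lookup rows r) c
  where
  rows : Vec (Vec ℕ 5) 5
  rows = (0 ∷ 0 ∷ 0 ∷ 0 ∷ 0 ∷ [])
       ∷ (0 ∷ 0 ∷ 0 ∷ 0 ∷ 0 ∷ [])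
       ∷ (0 ∷ 0 ∷ 0 ∷ 1 ∷ 1 ∷ [])
       ∷ (0 ∷ 0 ∷ 1 ∷ 1 ∷ 1 ∷ [])
       ∷ (0 ∷ 0 ∷ 1 ∷ 1 ∷ 1 ∷ [])
       ∷ []

-- Reflecting staircase moves the 1 of oneAt 1F 1F to any other cell.
orient : Fin 2 → Fin 5 → Fin 5
orient 0F = opposite
orient 1F = id

threshold : Fin 5 → ℕ
threshold r = if 2 ≤ᵇ toℕ r then 1 else 0

packing : ∀ {P} → Packable P → Mat 5
packing (single i j) r c = staircase (orient i r) (orient j c)
packing byRow      r _ = threshold r
packing byColumn   _ c = threshold c

40≤count-packing : ∀ {P} (p : Packable P) → 40 ≤ count P (packing p)
40≤count-packing (single 0F 0F) = ≤ᵇ⇒≤ 40 _ _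
40≤count-packing (single 0F 1F) = ≤ᵇ⇒≤ 40 _ _
40≤count-packing (single 1F 0F) = ≤ᵇ⇒≤ 40 _ _
40≤count-packing (single 1F 1F) = ≤ᵇ⇒≤ 40 _ _
40≤count-packing byRow         = ≤ᵇ⇒≤ 40 _ _
40≤count-packing byColumn      = ≤ᵇ⇒≤ 40 _ _

packable-image-¬minimizer : ∀ {H P} → Packable P → IsImageOf H P → ¬ Minimizer2 H
packable-image-¬minimizer p image minimizer =
  <⇒≱ (≤-trans (<ᵇ⇒< (51 * 5 ^ 4) (800 * 40) _) (*-monoʳ-≤ 800 (40≤count-packing p)))
      (minimizer⇒count-image-≤ minimizer image (s≤s (s≤s z≤n)) (packing p))

-- In hypothesis names, a, b, c, d stand for the cells 0F 0F, 0F 1F, 1F 0F, 1F 1F.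
refines-A₀ : ∀ {R : Mat2} →
             R 0F 0F ≢ R 0F 1F → R 0F 0F ≢ R 1F 0F → R 1F 1F ≢ R 0F 1F → R 1F 1F ≢ R 1F 0F →
             IsRefinement R A₀
refines-A₀ ab ac db dc = λ where
  0F 0F 0F 0F → contradiction refl
  0F 0F 0F 1F → const ab
  0F 0F 1F 0F → const ac
  0F 0F 1F 1F → contradiction refl
  0F 1F 0F 0F → const (ab ∘ sym)
  0F 1F 0F 1F → contradiction refl
  0F 1F 1F 0F → contradiction refl
  0F 1F 1F 1F → const (db ∘ sym)
  1F 0F 0F 0F → const (ac ∘ sym)
  1F 0F 0F 1F → contradiction refl
  1F 0F 1F 0F → contradiction refl
  1F 0F 1F 1F → const (dc ∘ sym)
  1F 1F 0F 0F → contradiction refl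
  1F 1F 0F 1F → const db
  1F 1F 1F 0F → const dc
  1F 1F 1F 1F → contradiction refl

refines-B₀ : ∀ {R : Mat2} →
             R 0F 0F ≢ R 1F 0F → R 0F 0F ≢ R 1F 1F → R 0F 1F ≢ R 1F 0F → R 0F 1F ≢ R 1F 1F →
             R 1F 0F ≢ R 1F 1F → IsRefinement R B₀
refines-B₀ ac ad bc bd cd = λ where
  0F 0F 0F 0F → contradiction refl
  0F 0F 0F 1F → contradiction refl
  0F 0F 1F 0F → const ac
  0F 0F 1F 1F → const ad
  0F 1F 0F 0F → contradiction refl
  0F 1F 0F 1F → contradiction refl
  0F 1F 1F 0F → const bc
  0F 1F 1F 1F → const bd
  1F 0F 0F 0F → const (ac ∘ sym)
  1F 0F 0F 1F → const (bc ∘ sym)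
  1F 0F 1F 0F → contradiction refl
  1F 0F 1F 1F → const cd
  1F 1F 0F 0F → const (ad ∘ sym)
  1F 1F 0F 1F → const (bd ∘ sym)
  1F 1F 1F 0F → const (cd ∘ sym)
  1F 1F 1F 1F → contradiction refl

relabel : ℕ → ℕ → ℕ → ℕ
relabel x y 0       = x
relabel x y (suc _) = y

image-of : ∀ {H P} (σ : ℕ → ℕ) →
           H 0F 0F ≡ σ (P 0F 0F) → H 0F 1F ≡ σ (P 0F 1F) →
           H 1F 0F ≡ σ (P 1F 0F) → H 1F 1F ≡ σ (P 1F 1F) →
           IsImageOf H P
image-of σ e₀₀ e₀₁ e₁₀ e₁₁ = σ , λ where
  0F 0F → e₀₀
  0F 1F → e₀₁
  1F 0F → e₁₀
  1F 1F → e₁₁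

Canonical : Mat2 → Set
Canonical H = ∃ λ R → DensityIso H R × (IsRefinement R A₀ ⊎ IsRefinement R B₀)

Degenerate : Mat2 → Set
Degenerate H = ∃ λ P → Packable P × IsImageOf H P

classify : ∀ H → Canonical H ⊎ Degenerate H
classify H with H 0F 0F ≟ H 0F 1F
... | yes ab with H 1F 0F ≟ H 1F 1F
...   | yes cd = inj₂ (_ , byRow , image-of (relabel (H 0F 0F) (H 1F 0F)) refl (sym ab) refl (sym cd))
...   | no cd with H 0F 0F ≟ H 1F 0F
...     | yes ac = inj₂ (_ , single 1F 1F , image-of (relabel (H 0F 0F) (H 1F 1F)) refl (sym ab) (sym ac) refl)
...     | no ac with H 0F 0F ≟ H 1F 1F
...       | yes ad = inj₂ (_ , single 1F 0F , image-of (relabel (H 0F 0F) (H 1F 0F)) refl (sym ab) refl (sym ad))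
...       | no ad = inj₁ (H , ε , inj₂ (refines-B₀ ac ad (ac ∘ trans ab) (ad ∘ trans ab) cd))
classify H | no ab with H 0F 0F ≟ H 1F 0F
... | yes ac with H 0F 1F ≟ H 1F 1F
...   | yes bd = inj₂ (_ , byColumn , image-of (relabel (H 0F 0F) (H 0F 1F)) refl refl (sym ac) (sym bd))
...   | no bd with H 0F 0F ≟ H 1F 1F
...     | yes ad = inj₂ (_ , single 0F 1F , image-of (relabel (H 0F 0F) (H 0F 1F)) refl refl (sym ac) (sym ad))
...     | no ad = inj₁ (_ , transpose H ◅ ε , inj₂ (refines-B₀ ab ad (ab ∘ trans ac) (ad ∘ trans ac) bd))
classify H | no ab | no ac with H 1F 1F ≟ H 0F 1F
... | yes db with H 1F 1F ≟ H 1F 0F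
...   | yes dc = inj₂ (_ , single 0F 0F , image-of (relabel (H 0F 1F) (H 0F 0F)) refl refl (trans (sym dc) db) db)
...   | no dc = inj₁ (_ , transpose H ◅ revRows _ ◅ ε ,
                      inj₂ (refines-B₀ (ab ∘ sym) (dc ∘ trans db) (λ d≡a → ab (trans (sym d≡a) db)) dc ac))
classify H | no ab | no ac | no db with H 1F 1F ≟ H 1F 0F
... | yes dc = inj₁ (_ , revRows H ◅ ε ,
                     inj₂ (refines-B₀ (ac ∘ sym) (db ∘ trans dc) (λ d≡a → ac (trans (sym d≡a) dc)) db ab))
... | no dc = inj₁ (H , ε , inj₁ (refines-A₀ ab ac db dc))

corollary1 : (H : Mat2) → Minimizer2 H →
    ∃ λ (R : Mat2) → DensityIso H R × (IsRefinement R A₀ ⊎ IsRefinement R B₀)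
corollary1 H minimizer with classify H
... | inj₁ canonical              = canonical
... | inj₂ (_ , packable , image) = ⊥-elim (packable-image-¬minimizer packable image minimizer)
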